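{- Let $a\le -1$ be an integer. Define $a_{\mathcal{G}}(n)$, $n\ge0$, by $a_{\mathcal{G}}(0)=1$, $a_{\mathcal{G}}(1)=-1$, $a_{\mathcal{G}}(2)=a$ and, for $n\ge3$, $$a_{\mathcal{G}}(n)=-\frac12\left(\sum_{k=0}^{n-2}a_{\mathcal{G}}(k)\binom{n-1}{k}2^{n-1-k}+\sum_{k=0}^{n-1}a_{\mathcal{G}}(k)\binom{n}{k}2^{n-k}\right).$$ For integers $0\le j\le d$ set $c_{\mathcal{G}}(j,d)=\sum_{k=j}^d2^{ -k}\binom{d-j}{d-k}a_{\mathcal{G}}(k)$. Then for all $d\ge0$ and $0\le j\le d$, $c_{\mathcal{G}}(j,d)=(-1)^dc_{\mathcal{G}}(d-j,d)$. -}

module Defs where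

open import Data.Nat using (ℕ; zero; suc; _∸_; _≤ᵇ_)
open import Data.Nat.Combinatorics using (_C_)
open import Data.Integer using (ℤ)
open import Data.Bool using (if_then_else_)
open import Data.Rational using (ℚ; _+_; _*_; -_; 1ℚ; 0ℚ; ½; _/_)
open import Data.Nat using () renaming (_+_ to _+ℕ_)
import Data.Rational as Q

ℕ→ℚ : ℕ → ℚ
ℕ→ℚ n = Q._/_ (Data.Integer.+ n) 1

ℤ→ℚ : ℤ → ℚ
ℤ→ℚ z = Q._/_ z 1

Σ< : ℕ → (ℕ → ℚ) → ℚ
Σ< zero    f = 0ℚ
Σ< (suc n) f = Σ< n f + f n

Σ[_to_] : ℕ → ℕ → (ℕ → ℚ) → ℚ
Σ[ j to d ] f = Σ< (suc d ∸ j) (λ i → f (j +ℕ i))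

two : ℚ
two = ℕ→ℚ 2

_^ℚ_ : ℚ → ℕ → ℚ
q ^ℚ zero = 1ℚ
q ^ℚ suc n = q * (q ^ℚ n)

step : (ℕ → ℚ) → ℕ → ℚ
step g n = - (½ * ( Σ< (suc (n ∸ 2)) (λ k → g k * ℕ→ℚ ((n ∸ 1) C k) * (two ^ℚ (n ∸ 1 ∸ k)))
                  + Σ< n (λ k → g k * ℕ→ℚ (n C k) * (two ^ℚ (n ∸ k)))))

-- initial values: g 0 = 1, g 1 = -1, g 2 = a (other values irrelevant)
init : ℤ → ℕ → ℚ
init a zero = 1ℚ
init a (suc zero) = - 1ℚ
init a (suc (suc _)) = ℤ→ℚ a

-- pre a m : a function correct on all indices ≤ m
pre : ℤ → ℕ → (ℕ → ℚ)
pre a zero = init a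
pre a (suc m) = λ k →
  if (k Data.Nat.≡ᵇ suc m) then
    (if (3 ≤ᵇ suc m) then step (pre a m) (suc m) else init a (suc m))
  else pre a m k

aG : ℤ → ℕ → ℚ
aG a n = pre a n n

cG : ℤ → ℕ → ℕ → ℚ
cG a j d = Σ[ j to d ] (λ k → (½ ^ℚ k) * ℕ→ℚ ((d ∸ j) C (d ∸ k)) * aG a k)

-- Put b(k) = 2^{-k} a_G(k) and let E be the shift of sequences. Then c_G(j, j + m) is the
-- entry ((1 + E)^m b)(j) of the Pascal table built on b, and this table is symmetric up to
-- the sign (−1)^{m+j} once its first column, the binomial transform of b, is ((−1)^m b(m))_m.
-- That eigenvector property follows by strong induction from the fact that the signed
-- binomial transform is an involution: at even n the involution forces it outright; at odd
-- n = 2m + 1 the recurrence reduces to b(n) = −½ Σ_{k<n} C(n,k) b(k), because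
-- Σ_{k<2m} C(2m,k) b(k) vanishes by the even case.
module Submission where

open import Defs
open import Data.Nat using (ℕ; _≤_; _∸_)
open import Data.Integer using (ℤ; -[1+_])
open import Data.Rational using (ℚ; _*_; 1ℚ; -_)
open import Relation.Binary.PropositionalEquality using (_≡_)

open import Data.Bool using (true; false; if_then_else_)
open import Data.Empty using (⊥-elim)
open import Data.Nat as ℕ using (zero; suc; _<_; _≡ᵇ_)
import Data.Nat.Properties as ℕₚ
open import Data.Nat.Combinatorics using (_C_; nCk≡nC[n∸k]; k>n⇒nCk≡0; nCn≡1; nCk+nC[k+1]≡[n+1]C[k+1])
open import Data.Nat.Coprimality using (1-coprimeTo) renaming (sym to coprime-sym)
import Data.Integer.Properties as ℤₚ
open import Data.Rational using (mkℚ; _+_; 0ℚ; ½)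
open import Data.Rational.Properties
  using ( normalize-coprime; +-identityˡ; +-identityʳ; +-inverseʳ; +-assoc; +-comm
        ; *-identityˡ; *-identityʳ; *-assoc; *-zeroˡ; *-zeroʳ; *-distribʳ-+; *-distribˡ-+ )
open import Data.Rational.Solver using (module +-*-Solver)
open import Data.Sum using (inj₁; inj₂)
open import Relation.Binary.PropositionalEquality using (_≢_; refl; sym; trans; cong; cong₂; subst; module ≡-Reasoning)

open +-*-Solver
open ≡-Reasoning

ℕ→ℚ≡mkℚ : ∀ n → ℕ→ℚ n ≡ mkℚ (Data.Integer.+ n) 0 (coprime-sym (1-coprimeTo n))
ℕ→ℚ≡mkℚ n = normalize-coprime (coprime-sym (1-coprimeTo n))

ℕ→ℚ-+ : ∀ m n → ℕ→ℚ (m ℕ.+ n) ≡ ℕ→ℚ m + ℕ→ℚ n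
ℕ→ℚ-+ m n
  rewrite ℕ→ℚ≡mkℚ m | ℕ→ℚ≡mkℚ n | ℕₚ.*-identityʳ m | ℕₚ.*-identityʳ n | ℤₚ.+◃n≡+n m | ℤₚ.+◃n≡+n n
  = refl

^ℚ-+ : ∀ q m n → q ^ℚ (m ℕ.+ n) ≡ q ^ℚ m * q ^ℚ n
^ℚ-+ q zero    n = sym (*-identityˡ (q ^ℚ n))
^ℚ-+ q (suc m) n = begin
  q * q ^ℚ (m ℕ.+ n)        ≡⟨ cong (q *_) (^ℚ-+ q m n) ⟩
  q * (q ^ℚ m * q ^ℚ n)     ≡⟨ solve 3 (λ q x y → q :* (x :* y) := (q :* x) :* y) refl q (q ^ℚ m) (q ^ℚ n) ⟩
  (q * q ^ℚ m) * q ^ℚ n     ∎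

^ℚ-inverse : ∀ {p q} → p * q ≡ 1ℚ → ∀ k → p ^ℚ k * q ^ℚ k ≡ 1ℚ
^ℚ-inverse         pq zero    = refl
^ℚ-inverse {p} {q} pq (suc k) = begin
  (p * p ^ℚ k) * (q * q ^ℚ k)   ≡⟨ solve 4 (λ p q x y → (p :* x) :* (q :* y) := (p :* q) :* (x :* y)) refl p q (p ^ℚ k) (q ^ℚ k) ⟩
  (p * q) * (p ^ℚ k * q ^ℚ k)   ≡⟨ cong₂ _*_ pq (^ℚ-inverse pq k) ⟩
  1ℚ * 1ℚ                       ∎

1ℚ^ℚ : ∀ n → 1ℚ ^ℚ n ≡ 1ℚ
1ℚ^ℚ zero    = refl
1ℚ^ℚ (suc n) = cong (1ℚ *_) (1ℚ^ℚ n)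

sgn : ℕ → ℚ
sgn n = (- 1ℚ) ^ℚ n

sgn-sq : ∀ n → sgn n * sgn n ≡ 1ℚ
sgn-sq = ^ℚ-inverse refl

sgn-double : ∀ m → sgn (m ℕ.+ m) ≡ 1ℚ
sgn-double m = trans (^ℚ-+ (- 1ℚ) m m) (sgn-sq m)

sgn-∸ : ∀ {k n} → k ≤ n → sgn k ≡ sgn n * sgn (n ∸ k)
sgn-∸ {k} {n} k≤n = begin
  sgn k                                ≡⟨ *-identityʳ (sgn k) ⟨
  sgn k * 1ℚ                           ≡⟨ cong (sgn k *_) (sgn-sq (n ∸ k)) ⟨
  sgn k * (sgn (n ∸ k) * sgn (n ∸ k))  ≡⟨ *-assoc (sgn k) _ _ ⟨
  (sgn k * sgn (n ∸ k)) * sgn (n ∸ k)  ≡⟨ cong (_* sgn (n ∸ k)) (^ℚ-+ (- 1ℚ) k (n ∸ k)) ⟨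
  sgn (k ℕ.+ (n ∸ k)) * sgn (n ∸ k)    ≡⟨ cong (λ e → sgn e * sgn (n ∸ k)) (ℕₚ.m+[n∸m]≡n k≤n) ⟩
  sgn n * sgn (n ∸ k)                  ∎

Σ<-cong : ∀ n {f g : ℕ → ℚ} → (∀ k → k < n → f k ≡ g k) → Σ< n f ≡ Σ< n g
Σ<-cong zero    f≡g = refl
Σ<-cong (suc n) f≡g = cong₂ _+_ (Σ<-cong n (λ k k<n → f≡g k (ℕₚ.m<n⇒m<1+n k<n))) (f≡g n (ℕₚ.n<1+n n))

Σ<-distrib-+ : ∀ n (f g : ℕ → ℚ) → Σ< n (λ k → f k + g k) ≡ Σ< n f + Σ< n g
Σ<-distrib-+ zero    f g = refl
Σ<-distrib-+ (suc n) f g = begin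
  Σ< n (λ k → f k + g k) + (f n + g n)  ≡⟨ cong (_+ (f n + g n)) (Σ<-distrib-+ n f g) ⟩
  (Σ< n f + Σ< n g) + (f n + g n)
    ≡⟨ solve 4 (λ a b c d → (a :+ b) :+ (c :+ d) := (a :+ c) :+ (b :+ d)) refl (Σ< n f) (Σ< n g) (f n) (g n) ⟩
  (Σ< n f + f n) + (Σ< n g + g n)       ∎

*-distribˡ-Σ< : ∀ n c (f : ℕ → ℚ) → Σ< n (λ k → c * f k) ≡ c * Σ< n f
*-distribˡ-Σ< zero    c f = sym (*-zeroʳ c)
*-distribˡ-Σ< (suc n) c f = trans (cong (_+ c * f n) (*-distribˡ-Σ< n c f)) (sym (*-distribˡ-+ c (Σ< n f) (f n)))

Σ<-suc : ∀ n (f : ℕ → ℚ) → Σ< (suc n) f ≡ f 0 + Σ< n (λ k → f (suc k))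
Σ<-suc zero    f = +-comm 0ℚ (f 0)
Σ<-suc (suc n) f = begin
  Σ< (suc n) f + f (suc n)                     ≡⟨ cong (_+ f (suc n)) (Σ<-suc n f) ⟩
  (f 0 + Σ< n (λ k → f (suc k))) + f (suc n)   ≡⟨ +-assoc (f 0) _ _ ⟩
  f 0 + (Σ< n (λ k → f (suc k)) + f (suc n))   ∎

-- shiftPow α y m j is ((α + E)^m y)(j), where E is the shift (E y)(j) = y(j + 1).
shiftPow : ℚ → (ℕ → ℚ) → ℕ → ℕ → ℚ
shiftPow α y zero    j = y j
shiftPow α y (suc m) j = α * shiftPow α y m j + shiftPow α y m (suc j)

pascal : (ℕ → ℚ) → ℕ → ℕ → ℚ
pascal = shiftPow 1ℚ

binomialTerm : ℚ → (ℕ → ℚ) → ℕ → ℕ → ℕ → ℚ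
binomialTerm α y m j i = ℕ→ℚ (m C i) * (α ^ℚ (m ∸ i) * y (j ℕ.+ i))

shiftPow-expand : ∀ α y m j → Σ< (suc m) (binomialTerm α y m j) ≡ shiftPow α y m j
shiftPow-expand α y zero j = begin
  0ℚ + ℕ→ℚ 1 * (1ℚ * y (j ℕ.+ 0))   ≡⟨ cong (λ i → 0ℚ + ℕ→ℚ 1 * (1ℚ * y i)) (ℕₚ.+-identityʳ j) ⟩
  0ℚ + ℕ→ℚ 1 * (1ℚ * y j)           ≡⟨ solve 1 (λ x → con 0ℚ :+ con (ℕ→ℚ 1) :* (con 1ℚ :* x) := x) refl (y j) ⟩
  y j                               ∎
shiftPow-expand α y (suc m) j = begin
  Σ< (suc (suc m)) (t (suc m) j)
    ≡⟨ Σ<-suc (suc m) (t (suc m) j) ⟩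
  t (suc m) j 0 + Σ< (suc m) (λ i → t (suc m) j (suc i))
    ≡⟨ cong (t (suc m) j 0 +_) (trans (Σ<-cong (suc m) (λ i _ → pascal-rule i)) (Σ<-distrib-+ (suc m) _ _)) ⟩
  t (suc m) j 0 + (Σ< (suc m) (λ i → v (suc i)) + Σ< (suc m) (t m (suc j)))
    ≡⟨ +-assoc (t (suc m) j 0) _ _ ⟨
  (t (suc m) j 0 + Σ< (suc m) (λ i → v (suc i))) + Σ< (suc m) (t m (suc j))
    ≡⟨ cong₂ _+_ α-part (shiftPow-expand α y m (suc j)) ⟩
  α * shiftPow α y m j + shiftPow α y m (suc j)
    ∎
  where
  t : ℕ → ℕ → ℕ → ℚ
  t = binomialTerm α y

  v : ℕ → ℚ
  v i = ℕ→ℚ (m C i) * (α ^ℚ (suc m ∸ i) * y (j ℕ.+ i))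

  pascal-rule : ∀ i → t (suc m) j (suc i) ≡ v (suc i) + t m (suc j) i
  pascal-rule i = begin
    ℕ→ℚ (suc m C suc i) * w                  ≡⟨ cong (λ c → ℕ→ℚ c * w) (nCk+nC[k+1]≡[n+1]C[k+1] m i) ⟨
    ℕ→ℚ (m C i ℕ.+ m C suc i) * w            ≡⟨ cong (_* w) (ℕ→ℚ-+ (m C i) (m C suc i)) ⟩
    (ℕ→ℚ (m C i) + ℕ→ℚ (m C suc i)) * w      ≡⟨ *-distribʳ-+ w (ℕ→ℚ (m C i)) _ ⟩
    ℕ→ℚ (m C i) * w + v (suc i)              ≡⟨ +-comm _ (v (suc i)) ⟩
    v (suc i) + ℕ→ℚ (m C i) * w              ≡⟨ cong (λ k → v (suc i) + ℕ→ℚ (m C i) * (α ^ℚ (m ∸ i) * y k)) (ℕₚ.+-suc j i) ⟩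
    v (suc i) + t m (suc j) i                ∎
    where
    w : ℚ
    w = α ^ℚ (m ∸ i) * y (j ℕ.+ suc i)

  v-top : v (suc m) ≡ 0ℚ
  v-top = trans (cong (λ c → ℕ→ℚ c * x) (k>n⇒nCk≡0 (ℕₚ.n<1+n m))) (*-zeroˡ x)
    where
    x : ℚ
    x = α ^ℚ (suc m ∸ suc m) * y (j ℕ.+ suc m)

  v≡α*t : ∀ i → i < suc m → v i ≡ α * t m j i
  v≡α*t i i<1+m = begin
    ℕ→ℚ (m C i) * (α ^ℚ (suc m ∸ i) * y (j ℕ.+ i))
      ≡⟨ cong (λ e → ℕ→ℚ (m C i) * (α ^ℚ e * y (j ℕ.+ i))) (ℕₚ.+-∸-assoc 1 (ℕₚ.≤-pred i<1+m)) ⟩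
    ℕ→ℚ (m C i) * ((α * α ^ℚ (m ∸ i)) * y (j ℕ.+ i))
      ≡⟨ solve 4 (λ a c p x → c :* ((a :* p) :* x) := a :* (c :* (p :* x))) refl α (ℕ→ℚ (m C i)) (α ^ℚ (m ∸ i)) (y (j ℕ.+ i)) ⟩
    α * t m j i
      ∎

  α-part : t (suc m) j 0 + Σ< (suc m) (λ i → v (suc i)) ≡ α * shiftPow α y m j
  α-part = begin
    v 0 + Σ< (suc m) (λ i → v (suc i))   ≡⟨ Σ<-suc (suc m) v ⟨
    Σ< (suc m) v + v (suc m)             ≡⟨ cong (Σ< (suc m) v +_) v-top ⟩
    Σ< (suc m) v + 0ℚ                    ≡⟨ +-identityʳ _ ⟩
    Σ< (suc m) v                         ≡⟨ Σ<-cong (suc m) v≡α*t ⟩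
    Σ< (suc m) (λ i → α * t m j i)       ≡⟨ *-distribˡ-Σ< (suc m) α (t m j) ⟩
    α * Σ< (suc m) (t m j)               ≡⟨ cong (α *_) (shiftPow-expand α y m j) ⟩
    α * shiftPow α y m j                 ∎

pascal-expand : ∀ y m j → Σ< (suc m) (λ i → ℕ→ℚ (m C i) * y (j ℕ.+ i)) ≡ pascal y m j
pascal-expand y m j = trans (Σ<-cong (suc m) unit-power) (shiftPow-expand 1ℚ y m j)
  where
  unit-power : ∀ i → i < suc m → ℕ→ℚ (m C i) * y (j ℕ.+ i) ≡ binomialTerm 1ℚ y m j i
  unit-power i _ = cong (ℕ→ℚ (m C i) *_) (sym (trans (cong (_* y (j ℕ.+ i)) (1ℚ^ℚ (m ∸ i))) (*-identityˡ _)))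

-- Along the row index k, the shift of k ↦ ((1 + E)^k x)(j) is multiplication by 1 + E,
-- so (−1 + E)^n acts on it as E^n.
shiftPow-−1-pascal : ∀ x n k j → shiftPow (- 1ℚ) (λ k → pascal x k j) n k ≡ pascal x k (j ℕ.+ n)
shiftPow-−1-pascal x zero    k j = cong (pascal x k) (sym (ℕₚ.+-identityʳ j))
shiftPow-−1-pascal x (suc n) k j = begin
  - 1ℚ * shiftPow (- 1ℚ) y n k + shiftPow (- 1ℚ) y n (suc k)
    ≡⟨ cong₂ (λ u v → - 1ℚ * u + v) (shiftPow-−1-pascal x n k j) (shiftPow-−1-pascal x n (suc k) j) ⟩
  - 1ℚ * pascal x k (j ℕ.+ n) + (1ℚ * pascal x k (j ℕ.+ n) + pascal x k (suc (j ℕ.+ n)))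
    ≡⟨ solve 2 (λ u v → con (- 1ℚ) :* u :+ (con 1ℚ :* u :+ v) := v) refl (pascal x k (j ℕ.+ n)) (pascal x k (suc (j ℕ.+ n))) ⟩
  pascal x k (suc (j ℕ.+ n))
    ≡⟨ cong (pascal x k) (ℕₚ.+-suc j n) ⟨
  pascal x k (j ℕ.+ suc n)
    ∎
  where
  y : ℕ → ℚ
  y k = pascal x k j

binomialSum< : (ℕ → ℚ) → ℕ → ℚ
binomialSum< y n = Σ< n (λ k → ℕ→ℚ (n C k) * y k)

binomialSum : (ℕ → ℚ) → ℕ → ℚ
binomialSum y n = Σ< (suc n) (λ k → ℕ→ℚ (n C k) * y k)

binomialSum≡binomialSum<+ : ∀ y n → binomialSum y n ≡ binomialSum< y n + y n
binomialSum≡binomialSum<+ y n =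
  cong (binomialSum< y n +_) (trans (cong (λ c → ℕ→ℚ c * y n) (nCn≡1 n)) (*-identityˡ (y n)))

binomialSum≡pascal : ∀ y n → binomialSum y n ≡ pascal y n 0
binomialSum≡pascal y n = pascal-expand y n 0

binomialSum-sgn-involutive : ∀ y n → binomialSum (λ k → sgn k * binomialSum y k) n ≡ sgn n * y n
binomialSum-sgn-involutive y n = begin
  Σ< (suc n) (λ k → ℕ→ℚ (n C k) * (sgn k * binomialSum y k))
    ≡⟨ Σ<-cong (suc n) (λ k k<1+n → pull-sign k (ℕₚ.≤-pred k<1+n)) ⟩
  Σ< (suc n) (λ k → sgn n * binomialTerm (- 1ℚ) P n 0 k)
    ≡⟨ *-distribˡ-Σ< (suc n) (sgn n) _ ⟩
  sgn n * Σ< (suc n) (binomialTerm (- 1ℚ) P n 0)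
    ≡⟨ cong (sgn n *_) (shiftPow-expand (- 1ℚ) P n 0) ⟩
  sgn n * shiftPow (- 1ℚ) P n 0
    ≡⟨ cong (sgn n *_) (shiftPow-−1-pascal y n 0 0) ⟩
  sgn n * y n
    ∎
  where
  P : ℕ → ℚ
  P k = pascal y k 0

  pull-sign : ∀ k → k ≤ n → ℕ→ℚ (n C k) * (sgn k * binomialSum y k) ≡ sgn n * binomialTerm (- 1ℚ) P n 0 k
  pull-sign k k≤n = begin
    ℕ→ℚ (n C k) * (sgn k * binomialSum y k)
      ≡⟨ cong₂ (λ s x → ℕ→ℚ (n C k) * (s * x)) (sgn-∸ k≤n) (binomialSum≡pascal y k) ⟩
    ℕ→ℚ (n C k) * ((sgn n * sgn (n ∸ k)) * P k)
      ≡⟨ solve 4 (λ c s t x → c :* ((s :* t) :* x) := s :* (c :* (t :* x))) refl (ℕ→ℚ (n C k)) (sgn n) (sgn (n ∸ k)) (P k) ⟩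
    sgn n * binomialTerm (- 1ℚ) P n 0 k
      ∎

parity-induction : ∀ {ℓ} {P : ℕ → Set ℓ} →
  (∀ m → (∀ k → k < m ℕ.+ m → P k) → P (m ℕ.+ m)) →
  (∀ m → P (m ℕ.+ m) → P (suc (m ℕ.+ m))) →
  ∀ n → P n
parity-induction {P = P} even odd n = below (suc n) n (ℕₚ.m≤m+n (suc n) (suc n))
  where
  below : ∀ m k → k < m ℕ.+ m → P k
  below zero    k ()
  below (suc m) k k<2+2m with ℕₚ.m<1+n⇒m<n∨m≡n (subst (k <_) (cong suc (ℕₚ.+-suc m m)) k<2+2m)
  ... | inj₂ refl = odd m (even m (below m))
  ... | inj₁ k<1+2m with ℕₚ.m<1+n⇒m<n∨m≡n k<1+2m
  ...   | inj₁ k<2m = below m k k<2m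
  ...   | inj₂ refl = even m (below m)

-- The recurrence of a_G rewritten for b(n) = 2^{-n} a_G(n); only its odd instances are needed.
OddRecurrence : (ℕ → ℚ) → Set
OddRecurrence b =
  ∀ m → b (suc (m ℕ.+ m)) ≡ - (½ * (½ * binomialSum< b (m ℕ.+ m) + binomialSum< b (suc (m ℕ.+ m))))

binomialSum-sgn-eigen : ∀ {b} → OddRecurrence b → ∀ n → binomialSum b n ≡ sgn n * b n
binomialSum-sgn-eigen {b} recurrence n = begin
  binomialSum b n                          ≡⟨ *-identityˡ _ ⟨
  1ℚ * binomialSum b n                     ≡⟨ cong (_* binomialSum b n) (sgn-sq n) ⟨
  (sgn n * sgn n) * binomialSum b n        ≡⟨ *-assoc (sgn n) _ _ ⟩
  sgn n * (sgn n * binomialSum b n)        ≡⟨ cong (sgn n *_) (parity-induction {P = Agrees} agree-double agree-odd n) ⟩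
  sgn n * b n                              ∎
  where
  Agrees : ℕ → Set
  Agrees n = sgn n * binomialSum b n ≡ b n

  agree-even : ∀ n → sgn n ≡ 1ℚ → (∀ k → k < n → Agrees k) → Agrees n
  agree-even n even earlier = begin
    sgn n * binomialSum b n     ≡⟨ unsign ⟩
    binomialSum b n             ≡⟨ cancel (binomialSum< b n) (binomialSum≡binomialSum<+ b n) rows ⟩
    b n                         ∎
    where
    unsign : ∀ {x} → sgn n * x ≡ x
    unsign {x} = trans (cong (_* x) even) (*-identityˡ x)

    rows : binomialSum< b n + binomialSum b n ≡ b n
    rows = begin
      binomialSum< b n + binomialSum b n
        ≡⟨ cong₂ _+_ (Σ<-cong n (λ k k<n → cong (ℕ→ℚ (n C k) *_) (earlier k k<n))) unsign ⟨
      binomialSum< (λ k → sgn k * binomialSum b k) n + sgn n * binomialSum b n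
        ≡⟨ binomialSum≡binomialSum<+ (λ k → sgn k * binomialSum b k) n ⟨
      binomialSum (λ k → sgn k * binomialSum b k) n
        ≡⟨ binomialSum-sgn-involutive b n ⟩
      sgn n * b n
        ≡⟨ unsign ⟩
      b n
        ∎

    cancel : ∀ {x} s {y} → x ≡ s + y → s + x ≡ y → x ≡ y
    cancel {x} s {y} x≡s+y s+x≡y = begin
      x                           ≡⟨ solve 2 (λ x s → x := con ½ :* (x :+ (s :+ x) :+ :- s)) refl x s ⟩
      ½ * (x + (s + x) + - s)     ≡⟨ cong₂ (λ u v → ½ * (u + v + - s)) x≡s+y s+x≡y ⟩
      ½ * ((s + y) + y + - s)     ≡⟨ solve 2 (λ s y → con ½ :* ((s :+ y) :+ y :+ :- s) := y) refl s y ⟩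
      y                           ∎

  agree-double : ∀ m → (∀ k → k < m ℕ.+ m → Agrees k) → Agrees (m ℕ.+ m)
  agree-double m = agree-even (m ℕ.+ m) (sgn-double m)

  agree-odd : ∀ m → Agrees (m ℕ.+ m) → Agrees (suc (m ℕ.+ m))
  agree-odd m agrees = begin
    (- 1ℚ * sgn 2m) * binomialSum b (suc 2m)  ≡⟨ cong (λ s → (- 1ℚ * s) * binomialSum b (suc 2m)) (sgn-double m) ⟩
    - 1ℚ * binomialSum b (suc 2m)             ≡⟨ cong (- 1ℚ *_) (binomialSum≡binomialSum<+ b (suc 2m)) ⟩
    - 1ℚ * (S′ + b (suc 2m))                  ≡⟨ cong (λ x → - 1ℚ * (S′ + x)) b-odd ⟩
    - 1ℚ * (S′ + - (½ * S′))                  ≡⟨ solve 1 (λ t → con (- 1ℚ) :* (t :+ :- (con ½ :* t)) := :- (con ½ :* t)) refl S′ ⟩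
    - (½ * S′)                                ≡⟨ b-odd ⟨
    b (suc 2m)                                ∎
    where
    2m : ℕ
    2m = m ℕ.+ m

    S S′ : ℚ
    S = binomialSum< b 2m
    S′ = binomialSum< b (suc 2m)

    unsigned : binomialSum b 2m ≡ b 2m
    unsigned = trans (sym (*-identityˡ (binomialSum b 2m))) (trans (cong (_* binomialSum b 2m) (sym (sgn-double m))) agrees)

    S≡0 : S ≡ 0ℚ
    S≡0 = begin
      S                          ≡⟨ solve 2 (λ s x → s := (s :+ x) :+ :- x) refl S (b 2m) ⟩
      (S + b 2m) + - b 2m        ≡⟨ cong (_+ - b 2m) (binomialSum≡binomialSum<+ b 2m) ⟨
      binomialSum b 2m + - b 2m  ≡⟨ cong (_+ - b 2m) unsigned ⟩
      b 2m + - b 2m              ≡⟨ +-inverseʳ (b 2m) ⟩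
      0ℚ                         ∎

    b-odd : b (suc 2m) ≡ - (½ * S′)
    b-odd = begin
      b (suc 2m)               ≡⟨ recurrence m ⟩
      - (½ * (½ * S + S′))     ≡⟨ cong (λ x → - (½ * (½ * x + S′))) S≡0 ⟩
      - (½ * (½ * 0ℚ + S′))    ≡⟨ cong (λ x → - (½ * x)) (+-identityˡ S′) ⟩
      - (½ * S′)               ∎

pascal-sym : ∀ {y} → (∀ m → pascal y m 0 ≡ sgn m * y m) → ∀ j m → pascal y m j ≡ sgn (m ℕ.+ j) * pascal y j m
pascal-sym {y} first-column zero    m = trans (first-column m) (cong (λ e → sgn e * y m) (sym (ℕₚ.+-identityʳ m)))
pascal-sym {y} first-column (suc j) m = begin
  P m (suc j)
    ≡⟨ solve 2 (λ u v → v := (con 1ℚ :* u :+ v) :+ :- (con 1ℚ :* u)) refl (P m j) (P m (suc j)) ⟩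
  P (suc m) j + - (1ℚ * P m j)
    ≡⟨ cong₂ (λ u v → u + - (1ℚ * v)) (pascal-sym first-column j (suc m)) (pascal-sym first-column j m) ⟩
  (- 1ℚ * s) * P j (suc m) + - (1ℚ * (s * P j m))
    ≡⟨ solve 3 (λ s u v → (con (- 1ℚ) :* s) :* v :+ :- (con 1ℚ :* (s :* u))
                        := (con (- 1ℚ) :* s) :* (con 1ℚ :* u :+ v))
               refl s (P j m) (P j (suc m)) ⟩
  (- 1ℚ * s) * P (suc j) m
    ≡⟨ cong (λ e → sgn e * P (suc j) m) (ℕₚ.+-suc m j) ⟨
  sgn (m ℕ.+ suc j) * P (suc j) m
    ∎
  where
  P : ℕ → ℕ → ℚ
  P = pascal y

  s : ℚ
  s = sgn (m ℕ.+ j)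

rescale : (ℕ → ℚ) → ℕ → ℚ
rescale g k = ½ ^ℚ k * g k

scaled-binomialSum< : ∀ g n → Σ< n (λ k → g k * ℕ→ℚ (n C k) * two ^ℚ (n ∸ k)) ≡ two ^ℚ n * binomialSum< (rescale g) n
scaled-binomialSum< g n =
  trans (Σ<-cong n (λ k k<n → pull-power k (ℕₚ.<⇒≤ k<n))) (*-distribˡ-Σ< n (two ^ℚ n) _)
  where
  pull-power : ∀ k → k ≤ n → g k * ℕ→ℚ (n C k) * two ^ℚ (n ∸ k) ≡ two ^ℚ n * (ℕ→ℚ (n C k) * rescale g k)
  pull-power k k≤n = begin
    x * c * t                                   ≡⟨ *-identityˡ _ ⟨
    1ℚ * (x * c * t)                            ≡⟨ cong (_* (x * c * t)) (^ℚ-inverse refl k) ⟨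
    (½ ^ℚ k * two ^ℚ k) * (x * c * t)
      ≡⟨ solve 5 (λ h u x c t → (h :* u) :* (x :* c :* t) := (u :* t) :* (c :* (h :* x))) refl (½ ^ℚ k) (two ^ℚ k) x c t ⟩
    (two ^ℚ k * t) * (c * rescale g k)          ≡⟨ cong (_* (c * rescale g k)) (^ℚ-+ two k (n ∸ k)) ⟨
    two ^ℚ (k ℕ.+ (n ∸ k)) * (c * rescale g k)  ≡⟨ cong (λ e → two ^ℚ e * (c * rescale g k)) (ℕₚ.m+[n∸m]≡n k≤n) ⟩
    two ^ℚ n * (c * rescale g k)                ∎
    where
    x c t : ℚ
    x = g k
    c = ℕ→ℚ (n C k)
    t = two ^ℚ (n ∸ k)

step-rescale : ∀ g p → ½ ^ℚ (3 ℕ.+ p) * step g (3 ℕ.+ p)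
  ≡ - (½ * (½ * binomialSum< (rescale g) (2 ℕ.+ p) + binomialSum< (rescale g) (3 ℕ.+ p)))
step-rescale g p = begin
  (½ * h) * - (½ * (Σ< (2 ℕ.+ p) _ + Σ< (3 ℕ.+ p) _))
    ≡⟨ cong (λ z → (½ * h) * z) (cong₂ (λ u v → - (½ * (u + v))) (scaled-binomialSum< g (2 ℕ.+ p)) (scaled-binomialSum< g (3 ℕ.+ p))) ⟩
  (½ * h) * - (½ * (t * S + (two * t) * S′))
    ≡⟨ solve 4 (λ h t S S′ → (con ½ :* h) :* (:- (con ½ :* (t :* S :+ (con two :* t) :* S′)))
                          := :- (con ½ :* ((h :* t) :* (con ½ :* S :+ S′))))
               refl h t S S′ ⟩
  - (½ * ((h * t) * (½ * S + S′)))
    ≡⟨ cong (λ z → - (½ * (z * (½ * S + S′)))) (^ℚ-inverse refl (2 ℕ.+ p)) ⟩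
  - (½ * (1ℚ * (½ * S + S′)))
    ≡⟨ cong (λ z → - (½ * z)) (*-identityˡ (½ * S + S′)) ⟩
  - (½ * (½ * S + S′))
    ∎
  where
  h t S S′ : ℚ
  h = ½ ^ℚ (2 ℕ.+ p)
  t = two ^ℚ (2 ℕ.+ p)
  S = binomialSum< (rescale g) (2 ℕ.+ p)
  S′ = binomialSum< (rescale g) (3 ℕ.+ p)

if-≡ᵇ-refl : ∀ {A : Set} n {x y : A} → (if n ≡ᵇ n then x else y) ≡ x
if-≡ᵇ-refl zero    = refl
if-≡ᵇ-refl (suc n) = if-≡ᵇ-refl n

if-≡ᵇ-≢ : ∀ {A : Set} {k n} {x y : A} → k ≢ n → (if k ≡ᵇ n then x else y) ≡ y
if-≡ᵇ-≢ {k = k} {n} k≢n with k ≡ᵇ n | ℕₚ.≡ᵇ⇒≡ k n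
... | true  | k≡n = ⊥-elim (k≢n (k≡n _))
... | false | _   = refl

pre-agrees : ∀ a {m k} → k ℕ.≤′ m → pre a m k ≡ aG a k
pre-agrees a ℕ.≤′-refl          = refl
pre-agrees a (ℕ.≤′-step k≤′m) =
  trans (if-≡ᵇ-≢ (ℕₚ.<⇒≢ (ℕ.s≤s (ℕₚ.≤′⇒≤ k≤′m)))) (pre-agrees a k≤′m)

aG-unfold : ∀ a p → aG a (3 ℕ.+ p) ≡ step (pre a (2 ℕ.+ p)) (3 ℕ.+ p)
aG-unfold a p = if-≡ᵇ-refl (3 ℕ.+ p)

aG-recurrence : ∀ a p → aG a (3 ℕ.+ p) ≡ step (aG a) (3 ℕ.+ p)
aG-recurrence a p = trans (aG-unfold a p)
  (cong₂ (λ u v → - (½ * (u + v)))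
    (Σ<-cong (2 ℕ.+ p) (λ k k< → cong (λ x → x * ℕ→ℚ ((2 ℕ.+ p) C k) * two ^ℚ (2 ℕ.+ p ∸ k)) (earlier k (ℕₚ.m<n⇒m<1+n k<))))
    (Σ<-cong (3 ℕ.+ p) (λ k k< → cong (λ x → x * ℕ→ℚ ((3 ℕ.+ p) C k) * two ^ℚ (3 ℕ.+ p ∸ k)) (earlier k k<))))
  where
  earlier : ∀ k → k < 3 ℕ.+ p → pre a (2 ℕ.+ p) k ≡ aG a k
  earlier k k< = pre-agrees a (ℕₚ.≤⇒≤′ (ℕₚ.≤-pred k<))

rescale-aG-odd-recurrence : ∀ a → OddRecurrence (rescale (aG a))
rescale-aG-odd-recurrence a zero    = refl
rescale-aG-odd-recurrence a (suc m) = subst RecurrenceAfter (cong suc (sym (ℕₚ.+-suc m m)))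
  (trans (cong (½ ^ℚ (3 ℕ.+ (m ℕ.+ m)) *_) (aG-recurrence a (m ℕ.+ m))) (step-rescale (aG a) (m ℕ.+ m)))
  where
  b : ℕ → ℚ
  b = rescale (aG a)

  RecurrenceAfter : ℕ → Set
  RecurrenceAfter n = b (suc n) ≡ - (½ * (½ * binomialSum< b n + binomialSum< b (suc n)))

cG≡pascal : ∀ a {j d} → j ≤ d → cG a j d ≡ pascal (rescale (aG a)) (d ∸ j) j
cG≡pascal a {j} {d} j≤d = begin
  Σ< (suc d ∸ j) term                              ≡⟨ cong (λ n → Σ< n term) (ℕₚ.+-∸-assoc 1 j≤d) ⟩
  Σ< (suc m) term                                  ≡⟨ Σ<-cong (suc m) (λ i i<1+m → reorder i (ℕₚ.≤-pred i<1+m)) ⟩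
  Σ< (suc m) (λ i → ℕ→ℚ (m C i) * b (j ℕ.+ i))     ≡⟨ pascal-expand b m j ⟩
  pascal b m j                                     ∎
  where
  m : ℕ
  m = d ∸ j

  b : ℕ → ℚ
  b = rescale (aG a)

  term : ℕ → ℚ
  term i = ½ ^ℚ (j ℕ.+ i) * ℕ→ℚ (m C (d ∸ (j ℕ.+ i))) * aG a (j ℕ.+ i)

  reorder : ∀ i → i ≤ m → term i ≡ ℕ→ℚ (m C i) * b (j ℕ.+ i)
  reorder i i≤m = begin
    ½ ^ℚ (j ℕ.+ i) * ℕ→ℚ (m C (d ∸ (j ℕ.+ i))) * aG a (j ℕ.+ i)
      ≡⟨ cong (λ e → ½ ^ℚ (j ℕ.+ i) * ℕ→ℚ (m C e) * aG a (j ℕ.+ i)) (ℕₚ.∸-+-assoc d j i) ⟨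
    ½ ^ℚ (j ℕ.+ i) * ℕ→ℚ (m C (m ∸ i)) * aG a (j ℕ.+ i)
      ≡⟨ cong (λ e → ½ ^ℚ (j ℕ.+ i) * ℕ→ℚ e * aG a (j ℕ.+ i)) (nCk≡nC[n∸k] i≤m) ⟨
    ½ ^ℚ (j ℕ.+ i) * ℕ→ℚ (m C i) * aG a (j ℕ.+ i)
      ≡⟨ solve 3 (λ h c x → h :* c :* x := c :* (h :* x)) refl (½ ^ℚ (j ℕ.+ i)) (ℕ→ℚ (m C i)) (aG a (j ℕ.+ i)) ⟩
    ℕ→ℚ (m C i) * b (j ℕ.+ i)
      ∎

-- The identity holds for every integer a.
mainTheorem13 : (a : ℤ) → a Data.Integer.≤ -[1+ 0 ] → (d j : ℕ) → j ≤ d →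
    cG a j d ≡ ((- 1ℚ) ^ℚ d) * cG a (d ∸ j) d
mainTheorem13 a _ d j j≤d = begin
  cG a j d                                ≡⟨ cG≡pascal a j≤d ⟩
  pascal b (d ∸ j) j                      ≡⟨ pascal-sym first-column j (d ∸ j) ⟩
  sgn (d ∸ j ℕ.+ j) * pascal b j (d ∸ j)  ≡⟨ cong₂ (λ e i → sgn e * pascal b i (d ∸ j)) (ℕₚ.m∸n+n≡m j≤d) (sym (ℕₚ.m∸[m∸n]≡n j≤d)) ⟩
  sgn d * pascal b (d ∸ (d ∸ j)) (d ∸ j)  ≡⟨ cong (sgn d *_) (cG≡pascal a (ℕₚ.m∸n≤m d j)) ⟨
  sgn d * cG a (d ∸ j) d                  ∎
  where
  b : ℕ → ℚ
  b = rescale (aG a)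

  first-column : ∀ m → pascal b m 0 ≡ sgn m * b m
  first-column m = trans (sym (binomialSum≡pascal b m)) (binomialSum-sgn-eigen (rescale-aG-odd-recurrence a) m)
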